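{- Let $G$ be an abelian group of odd order. Then up to $G$-equivariant isometry there is a unique $G$-invariant, symmetric, nondegenerate $\mathbb{F}_2$-bilinear form on $\mathbb{F}_2[G]$, namely $$b\colon\mathbb{F}_2[G]\times\mathbb{F}_2[G]\to\mathbb{F}_2,\qquad b(x,y)=\operatorname{Tr}(x^*y).$$ That is, $b$ is $G$-invariant, symmetric and nondegenerate, and for every $G$-invariant symmetric nondegenerate $\mathbb{F}_2$-bilinear form $b'$ on $\mathbb{F}_2[G]$ there is a $G$-equivariant $\mathbb{F}_2$-linear automorphism $\phi$ of $\mathbb{F}_2[G]$ with $b'(\phi x,\phi y)=b(x,y)$ for all $x,y$.
   Context: $x\mapsto x^*$ is the $\mathbb{F}_2$-linear involution of $\mathbb{F}_2[G]$ extending $\sigma\mapsto\sigma^{ -1}$ for $\sigma\in G$. $\operatorname{Tr}\colon\mathbb{F}_2[G]\to\mathbb{F}_2$ is the trace of the commutative $\mathbb{F}_2$-algebra $\mathbb{F}_2[G]$ (trace of multiplication). A form $b$ is $G$-invariant if $b(\sigma x,\sigma y)=b(x,y)$ for all $\sigma\in G$. -}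

module Defs where

open import Data.Nat using (ℕ; zero; suc)
open import Data.Fin using (Fin; zero; suc; _≟_)
open import Data.Bool using (Bool; true; false; _xor_; _∧_)
open import Data.Vec using (Vec; tabulate; lookup; replicate; zipWith; map)
open import Data.Product using (Σ; _×_; _,_)
open import Relation.Nullary.Decidable using (⌊_⌋)
open import Relation.Binary.PropositionalEquality using (_≡_)
open import Algebra.Structures using (IsAbelianGroup)
open import Function using (_∘_)

-- A finite abelian group, with carrier Fin order (every finite group is
-- isomorphic to one of this form).
record FinAbGroup : Set where
  field
    order   : ℕ
    _·_     : Fin order → Fin order → Fin order
    e       : Fin order
    _⁻¹     : Fin order → Fin order
    isAbGrp : IsAbelianGroup _≡_ _·_ e _⁻¹

-- F₂ is modelled by Bool with + = xor and · = ∧.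
-- Sum over Fin n in F₂.
sumF : ∀ {n} → (Fin n → Bool) → Bool
sumF {zero}  f = false
sumF {suc n} f = f zero xor sumF (f ∘ suc)

module _ (G : FinAbGroup) where
  open FinAbGroup G

  -- The group algebra F₂[G]: coefficient vectors indexed by the elements of G.
  F₂[_] : Set
  F₂[_] = Vec Bool order

  zeroV : F₂[_]
  zeroV = replicate order false

  _+V_ : F₂[_] → F₂[_] → F₂[_]
  x +V y = zipWith _xor_ x y

  _•V_ : Bool → F₂[_] → F₂[_]
  c •V x = map (c ∧_) x

  δ : Fin order → F₂[_]
  δ g = tabulate (λ h → ⌊ h ≟ g ⌋)

  _*G_ : F₂[_] → F₂[_] → F₂[_]
  x *G y = tabulate (λ g → sumF (λ h → lookup x h ∧ lookup y ((h ⁻¹) · g)))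

  star : F₂[_] → F₂[_]
  star x = tabulate (λ g → lookup x (g ⁻¹))

  act : Fin order → F₂[_] → F₂[_]
  act σ x = δ σ *G x

  -- Tr(x) = trace of the F₂-linear map y ↦ x y, computed in the basis G:
  -- sum of the diagonal entries (coefficient of g in x·g).
  Tr : F₂[_] → Bool
  Tr x = sumF (λ g → lookup (x *G δ g) g)

  trForm : F₂[_] → F₂[_] → Bool
  trForm x y = Tr (star x *G y)

  Form : Set
  Form = F₂[_] → F₂[_] → Bool

  IsBilinear : Form → Set
  IsBilinear b =
    (∀ x y z → b (x +V y) z ≡ b x z xor b y z) ×
    (∀ c x z → b (c •V x) z ≡ c ∧ b x z) ×
    (∀ x y z → b x (y +V z) ≡ b x y xor b x z) ×
    (∀ c x z → b x (c •V z) ≡ c ∧ b x z)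

  IsSymmetric : Form → Set
  IsSymmetric b = ∀ x y → b x y ≡ b y x

  IsNondegenerate : Form → Set
  IsNondegenerate b = ∀ x → (∀ y → b x y ≡ false) → x ≡ zeroV

  IsGInvariant : Form → Set
  IsGInvariant b = ∀ σ x y → b (act σ x) (act σ y) ≡ b x y

  IsLinear : (F₂[_] → F₂[_]) → Set
  IsLinear φ = (∀ x y → φ (x +V y) ≡ φ x +V φ y) × (∀ c x → φ (c •V x) ≡ c •V φ x)

  IsGEquivariant : (F₂[_] → F₂[_]) → Set
  IsGEquivariant φ = ∀ σ x → φ (act σ x) ≡ act σ (φ x)

  IsBijective : (F₂[_] → F₂[_]) → Set
  IsBijective φ = Σ (F₂[_] → F₂[_]) λ ψ → (∀ x → ψ (φ x) ≡ x) × (∀ x → φ (ψ x) ≡ x)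

  EquivIsometry : Form → Form → Set
  EquivIsometry b b' = Σ (F₂[_] → F₂[_]) λ φ →
    IsLinear φ × IsBijective φ × IsGEquivariant φ × (∀ x y → b' (φ x) (φ y) ≡ b x y)

module Submission where

open import Defs
open import Data.Nat using (zero; suc; _^_)
open import Data.Nat.Properties using (n<1+n)
open import Data.Nat.Divisibility using (_∣_; _∣0; ∣m∣n⇒∣m+n; ∣-refl)
open import Data.Fin using (Fin; zero; suc; _≟_; _<?_; punchOut)
open import Data.Fin.Properties using (<-cmp; pigeonhole; any?; punchOut-injective; <⇒≢; *↔×; 2↔Bool; suc-injective)
open import Data.Fin.Permutation using (permutation)
open import Data.Bool using (Bool; true; false; _xor_; _∧_)
open import Data.Bool.Properties
  using (∧-comm; ∧-assoc; ∧-idem; ∧-identityʳ; ∧-zeroʳ; ∧-distribˡ-xor; ∧-distribʳ-xor;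
         xor-same; xor-identityʳ; not-involutive; xor-∧-commutativeRing; ∧-commutativeMonoid)
open import Data.Vec using (Vec; []; _∷_; lookup; tabulate)
open import Data.Vec.Properties
  using (lookup∘tabulate; tabulate∘lookup; tabulate-cong; lookup-zipWith; lookup-map; lookup-replicate)
open import Data.Product using (_,_; _×_; proj₁; proj₂; ∃; uncurry)
open import Data.Product.Function.NonDependent.Propositional using (_×-↔_)
open import Data.Empty using (⊥-elim)
open import Function using (_∘_; _↔_; mk↔ₛ′; Inverse; Injective)
open import Function.Properties.Inverse using (↔-sym; ↔-trans)
open import Level using (0ℓ)
open import Algebra.Bundles using (AbelianGroup; CommutativeMonoid; CommutativeRing)
import Algebra.Properties.AbelianGroup as AbelianGroupProperties
import Algebra.Properties.CommutativeSemigroup as CommutativeSemigroupProperties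
import Algebra.Properties.Semiring.Sum as SemiringSum
open import Relation.Binary using (tri<; tri≈; tri>)
open import Relation.Binary.PropositionalEquality
  using (_≡_; _≢_; refl; sym; trans; cong; cong₂; module ≡-Reasoning)
open import Relation.Nullary using (¬_; Dec; yes; no)
open import Relation.Nullary.Decidable using (⌊_⌋)

-- Write ⟨x , y⟩ = Σ_g x_g y_g for the standard form in the basis G.  The proof
-- has three ingredients.
--   * For every G, Tr(z) = |G|·z_e and ⟨x , y⟩ = (x* y)_e, so for |G| odd the
--     trace form Tr(x* y) is the standard form, which is visibly a G-form
--     (bilinear, G-invariant, symmetric, nondegenerate).
--   * Every G-invariant bilinear form b is b(x , y) = ⟨c x , y⟩, where c is its
--     Gram vector c_k = b(e , k).  Symmetry of b gives c* = c, and
--     nondegeneracy makes x ↦ c x injective, hence (F₂[G] being finite)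
--     bijective, so c a = 1 for some a, and then a* = a.
--   * Since |G| is odd, squaring is a bijection of G, and in characteristic 2
--     the element s = Σ_h a_{h²} h satisfies s² = a (Frobenius), s* = s.
-- Then φ(x) = s x is a G-equivariant linear automorphism with
-- b(s x , s y) = ⟨c s² x , y⟩ = ⟨x , y⟩.

module ∑ = SemiringSum (CommutativeRing.semiring xor-∧-commutativeRing)

sumF≡∑ : ∀ {n} (f : Fin n → Bool) → sumF f ≡ ∑.sum f
sumF≡∑ {zero}  f = refl
sumF≡∑ {suc n} f = cong (f zero xor_) (sumF≡∑ (f ∘ suc))

sumF-cong : ∀ {n} {f g : Fin n → Bool} → (∀ i → f i ≡ g i) → sumF f ≡ sumF g
sumF-cong {zero}  p = refl
sumF-cong {suc n} p = cong₂ _xor_ (p zero) (sumF-cong (p ∘ suc))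

sumF-false : ∀ {n} → sumF {n} (λ _ → false) ≡ false
sumF-false {zero}  = refl
sumF-false {suc n} = sumF-false {n}

sumF-xor : ∀ {n} (f g : Fin n → Bool) → sumF (λ i → f i xor g i) ≡ sumF f xor sumF g
sumF-xor f g = trans (sumF≡∑ (λ i → f i xor g i)) (trans (∑.∑-distrib-+ f g) (sym (cong₂ _xor_ (sumF≡∑ f) (sumF≡∑ g))))

sumF-∧ˡ : ∀ {n} c (f : Fin n → Bool) → sumF (λ i → c ∧ f i) ≡ c ∧ sumF f
sumF-∧ˡ c f = trans (sumF≡∑ (λ i → c ∧ f i)) (trans (sym (∑.*-distribˡ-sum c f)) (cong (c ∧_) (sym (sumF≡∑ f))))

sumF-∧ʳ : ∀ {n} c (f : Fin n → Bool) → sumF (λ i → f i ∧ c) ≡ sumF f ∧ c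
sumF-∧ʳ c f = trans (sumF≡∑ (λ i → f i ∧ c)) (trans (sym (∑.*-distribʳ-sum c f)) (cong (_∧ c) (sym (sumF≡∑ f))))

sumF-swap : ∀ {m n} (f : Fin m → Fin n → Bool) →
            sumF (λ i → sumF (λ j → f i j)) ≡ sumF (λ j → sumF (λ i → f i j))
sumF-swap f = trans (double f) (trans (∑.∑-comm f) (sym (double (λ j i → f i j))))
  where
  double : ∀ {m n} (f : Fin m → Fin n → Bool) → sumF (λ i → sumF (f i)) ≡ ∑.sum (λ i → ∑.sum (f i))
  double f = trans (sumF-cong (λ i → sumF≡∑ (f i))) (sumF≡∑ (λ i → ∑.sum (f i)))

sumF-reindex : ∀ {n} (f : Fin n → Bool) (π ρ : Fin n → Fin n) →
               (∀ i → π (ρ i) ≡ i) → (∀ i → ρ (π i) ≡ i) → sumF (f ∘ π) ≡ sumF f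
sumF-reindex f π ρ πρ ρπ =
  trans (sumF≡∑ (f ∘ π)) (trans (sym (∑.∑-permute f (permutation π ρ πρ ρπ))) (sym (sumF≡∑ f)))

eqᵇ : ∀ {n} → Fin n → Fin n → Bool
eqᵇ a b = ⌊ a ≟ b ⌋

eqᵇ-⇔ : ∀ {m n} {a b : Fin m} {c d : Fin n} → (a ≡ b → c ≡ d) → (c ≡ d → a ≡ b) → eqᵇ a b ≡ eqᵇ c d
eqᵇ-⇔ {a = a} {b} {c} {d} to from with a ≟ b | c ≟ d
... | yes _   | yes _   = refl
... | no  _   | no  _   = refl
... | yes a≡b | no  c≢d = ⊥-elim (c≢d (to a≡b))
... | no  a≢b | yes c≡d = ⊥-elim (a≢b (from c≡d))

sumF-delta : ∀ {n} (f : Fin n → Bool) (k : Fin n) → sumF (λ h → f h ∧ eqᵇ h k) ≡ f k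
sumF-delta {suc n} f zero    = trans (cong₂ _xor_ (∧-identityʳ (f zero))
  (trans (sumF-cong (λ h → ∧-zeroʳ (f (suc h)))) (sumF-false {n}))) (xor-identityʳ (f zero))
sumF-delta {suc n} f (suc k) = cong₂ _xor_ (∧-zeroʳ (f zero))
  (trans (sumF-cong (λ h → cong (f (suc h) ∧_) (eqᵇ-⇔ suc-injective (cong suc)))) (sumF-delta (f ∘ suc) k))

⌊⌋-yes : ∀ {A : Set} (d : Dec A) → A → ⌊ d ⌋ ≡ true
⌊⌋-yes (yes _) _ = refl
⌊⌋-yes (no ¬a) a = ⊥-elim (¬a a)

⌊⌋-no : ∀ {A : Set} (d : Dec A) → ¬ A → ⌊ d ⌋ ≡ false
⌊⌋-no (yes a) ¬a = ⊥-elim (¬a a)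
⌊⌋-no (no _)  _  = refl

ltᵇ : ∀ {n} → Fin n → Fin n → Bool
ltᵇ a b = ⌊ a <? b ⌋

-- Pairing argument: if f is constant on the orbits of an involution ι, each
-- orbit {h , ι h} of size two contributes f h + f h = 0, so only the fixed
-- points of ι survive.  Orbits are split by comparing h with ι h.
sumF-involution : ∀ {n} (f : Fin n → Bool) (ι : Fin n → Fin n) →
                  (∀ i → ι (ι i) ≡ i) → (∀ i → f (ι i) ≡ f i) →
                  sumF f ≡ sumF (λ h → f h ∧ eqᵇ (ι h) h)
sumF-involution {n} f ι ιι fι = begin
    sumF f
  ≡⟨ sumF-cong split ⟩
    sumF (λ h → (below h xor above h) xor fixed h)
  ≡⟨ trans (sumF-xor _ fixed) (cong (_xor sumF fixed) (sumF-xor below above)) ⟩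
    (sumF below xor sumF above) xor sumF fixed
  ≡⟨ cong (λ s → (sumF below xor s) xor sumF fixed) above≡below ⟩
    (sumF below xor sumF below) xor sumF fixed
  ≡⟨ cong (_xor sumF fixed) (xor-same (sumF below)) ⟩
    sumF fixed ∎
  where
  open ≡-Reasoning
  below above fixed : Fin n → Bool
  below h = f h ∧ ltᵇ h (ι h)
  above h = f h ∧ ltᵇ (ι h) h
  fixed h = f h ∧ eqᵇ (ι h) h

  trichotomy : ∀ h → (ltᵇ h (ι h) xor ltᵇ (ι h) h) xor eqᵇ (ι h) h ≡ true
  trichotomy h with <-cmp h (ι h)
  ... | tri< h<ιh h≢ιh ιh≮h
    rewrite ⌊⌋-yes (h <? ι h) h<ιh | ⌊⌋-no (ι h <? h) ιh≮h | ⌊⌋-no (ι h ≟ h) (h≢ιh ∘ sym) = refl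
  ... | tri≈ h≮ιh h≡ιh ιh≮h
    rewrite ⌊⌋-no (h <? ι h) h≮ιh | ⌊⌋-no (ι h <? h) ιh≮h | ⌊⌋-yes (ι h ≟ h) (sym h≡ιh) = refl
  ... | tri> h≮ιh h≢ιh ιh<h
    rewrite ⌊⌋-no (h <? ι h) h≮ιh | ⌊⌋-yes (ι h <? h) ιh<h | ⌊⌋-no (ι h ≟ h) (h≢ιh ∘ sym) = refl

  split : ∀ h → f h ≡ (below h xor above h) xor fixed h
  split h = begin
    f h                                                          ≡⟨ sym (∧-identityʳ (f h)) ⟩
    f h ∧ true                                                   ≡⟨ cong (f h ∧_) (sym (trichotomy h)) ⟩
    f h ∧ ((ltᵇ h (ι h) xor ltᵇ (ι h) h) xor eqᵇ (ι h) h)        ≡⟨ ∧-distribˡ-xor (f h) _ _ ⟩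
    f h ∧ (ltᵇ h (ι h) xor ltᵇ (ι h) h) xor fixed h              ≡⟨ cong (_xor fixed h) (∧-distribˡ-xor (f h) _ _) ⟩
    (below h xor above h) xor fixed h                            ∎

  -- ι exchanges the two halves of each orbit of size two
  above≡below : sumF above ≡ sumF below
  above≡below = trans (sym (sumF-reindex above ι ι ιι ιι))
    (sumF-cong (λ h → cong₂ _∧_ (fι h) (cong (λ j → ltᵇ j (ι h)) (ιι h))))

sumF-odd-const : ∀ n → ¬ 2 ∣ n → ∀ c → sumF {n} (λ _ → c) ≡ c
sumF-odd-const n odd c = begin
  sumF {n} (λ _ → c)           ≡⟨ sumF-cong {n} (λ _ → sym (∧-identityʳ c)) ⟩
  sumF {n} (λ _ → c ∧ true)    ≡⟨ sumF-∧ˡ {n} c (λ _ → true) ⟩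
  c ∧ sumF {n} (λ _ → true)    ≡⟨ cong (c ∧_) (count n odd) ⟩
  c ∧ true                     ≡⟨ ∧-identityʳ c ⟩
  c                            ∎
  where
  open ≡-Reasoning
  count : ∀ n → ¬ 2 ∣ n → sumF {n} (λ _ → true) ≡ true
  count zero          odd = ⊥-elim (odd (2 ∣0))
  count (suc zero)    _   = refl
  count (suc (suc n)) odd = trans (not-involutive _) (count n (odd ∘ ∣m∣n⇒∣m+n ∣-refl))

Fin-injective⇒surjective : ∀ {m} (f : Fin m → Fin m) → Injective _≡_ _≡_ f → ∀ y → ∃ λ i → f i ≡ y
Fin-injective⇒surjective {m} f inj y with any? (λ i → f i ≟ y)
... | yes hit = hit
Fin-injective⇒surjective {suc m} f inj y | no miss =
  let (i , j , i<j , same) = pigeonhole (n<1+n m) (λ i → punchOut (avoids i))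
  in ⊥-elim (<⇒≢ i<j (inj (punchOut-injective (avoids i) (avoids j) same)))
  where
  avoids : ∀ i → y ≢ f i
  avoids i y≡fi = miss (i , sym y≡fi)

↔Fin-injective⇒surjective : ∀ {A : Set} {k} → A ↔ Fin k →
  (f : A → A) → Injective _≡_ _≡_ f → ∀ y → ∃ λ x → f x ≡ y
↔Fin-injective⇒surjective A↔Fin f inj y =
  let (i , hit) = Fin-injective⇒surjective (to ∘ f ∘ from) injective (to y)
  in from i , trans (sym (strictlyInverseʳ (f (from i)))) (trans (cong from hit) (strictlyInverseʳ y))
  where
  open Inverse A↔Fin
  injective : Injective _≡_ _≡_ (to ∘ f ∘ from)
  injective {i} {j} same = trans (sym (strictlyInverseˡ i))
    (trans (cong to (inj (trans (sym (strictlyInverseʳ _)) (trans (cong from same) (strictlyInverseʳ _)))))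
           (strictlyInverseˡ j))

Bits↔Fin : ∀ n → Vec Bool n ↔ Fin (2 ^ n)
Bits↔Fin zero    = mk↔ₛ′ (λ _ → zero) (λ _ → []) (λ { zero → refl }) (λ { [] → refl })
Bits↔Fin (suc n) = ↔-trans uncons (↔-trans (↔-sym 2↔Bool ×-↔ Bits↔Fin n) (↔-sym *↔×))
  where
  uncons : Vec Bool (suc n) ↔ (Bool × Vec Bool n)
  uncons = mk↔ₛ′ (λ { (b ∷ bs) → b , bs }) (uncurry _∷_) (λ _ → refl) (λ { (_ ∷ _) → refl })

module ∧ = CommutativeSemigroupProperties (CommutativeMonoid.commutativeSemigroup ∧-commutativeMonoid)

vec-ext : ∀ {A : Set} {n} {x y : Vec A n} → (∀ i → lookup x i ≡ lookup y i) → x ≡ y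
vec-ext {x = x} {y} same = trans (sym (tabulate∘lookup x)) (trans (tabulate-cong same) (tabulate∘lookup y))

module GroupAlgebra (G : FinAbGroup) where
  open FinAbGroup G using (order; isAbGrp)

  abelianGroup : AbelianGroup 0ℓ 0ℓ
  abelianGroup = record { isAbelianGroup = isAbGrp }

  open AbelianGroup abelianGroup using (_∙_; ε; _⁻¹; assoc; comm; identityˡ; identityʳ; inverseˡ; inverseʳ; commutativeSemigroup)
  open AbelianGroupProperties abelianGroup
    using (ε⁻¹≈ε; x∙y⁻¹≈ε⇒x≈y; ⁻¹-involutive; ⁻¹-injective; ⁻¹-∙-comm; \\-leftDividesˡ; \\-leftDividesʳ; ∙-cancelˡ)
  open CommutativeSemigroupProperties commutativeSemigroup using (interchange)
  open ≡-Reasoning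

  reflect-involutive : ∀ g h → (h ⁻¹ ∙ g) ⁻¹ ∙ g ≡ h
  reflect-involutive g h = begin
    (h ⁻¹ ∙ g) ⁻¹ ∙ g        ≡⟨ cong (_∙ g) (sym (⁻¹-∙-comm (h ⁻¹) g)) ⟩
    h ⁻¹ ⁻¹ ∙ g ⁻¹ ∙ g       ≡⟨ assoc _ _ _ ⟩
    h ⁻¹ ⁻¹ ∙ (g ⁻¹ ∙ g)     ≡⟨ cong₂ _∙_ (⁻¹-involutive h) (inverseˡ g) ⟩
    h ∙ ε                    ≡⟨ identityʳ h ⟩
    h                        ∎

  reflect-fixed : ∀ g h → h ⁻¹ ∙ g ≡ h → h ∙ h ≡ g
  reflect-fixed g h fixed = trans (cong (h ∙_) (sym fixed)) (\\-leftDividesˡ h g)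

  sumF-inverse : ∀ (f : Fin order → Bool) → sumF (λ h → f (h ⁻¹)) ≡ sumF f
  sumF-inverse f = sumF-reindex f _⁻¹ _⁻¹ ⁻¹-involutive ⁻¹-involutive

  sumF-translate : ∀ σ (f : Fin order → Bool) → sumF (λ h → f (σ ∙ h)) ≡ sumF f
  sumF-translate σ f = sumF-reindex f (σ ∙_) (σ ⁻¹ ∙_) (\\-leftDividesˡ σ) (\\-leftDividesʳ σ)

  sumF-reflect : ∀ g (f : Fin order → Bool) → sumF (λ h → f (h ⁻¹ ∙ g)) ≡ sumF f
  sumF-reflect g f = sumF-reindex f (λ h → h ⁻¹ ∙ g) (λ h → h ⁻¹ ∙ g) (reflect-involutive g) (reflect-involutive g)

  V : Set
  V = F₂[ G ]

  infixl 9 _!_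
  _!_ : V → Fin order → Bool
  x ! g = lookup x g

  infixl 7 _⋆_
  _⋆_ : V → V → V
  _⋆_ = _*G_ G

  infixl 6 _⊕_
  _⊕_ : V → V → V
  _⊕_ = _+V_ G

  infixr 7 _•_
  _•_ : Bool → V → V
  _•_ = _•V_ G

  𝟘 : V
  𝟘 = zeroV G

  [_] : Fin order → V
  [_] = δ G

  infix 10 _^*
  _^* : V → V
  _^* = star G

  ⋆-coeff : ∀ x y g → (x ⋆ y) ! g ≡ sumF (λ h → x ! h ∧ y ! (h ⁻¹ ∙ g))
  ⋆-coeff x y g = lookup∘tabulate _ g

  ^*-coeff : ∀ x g → x ^* ! g ≡ x ! (g ⁻¹)
  ^*-coeff x g = lookup∘tabulate _ g

  []-coeff : ∀ k g → [ k ] ! g ≡ eqᵇ g k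
  []-coeff k g = lookup∘tabulate _ g

  ⊕-coeff : ∀ x y g → (x ⊕ y) ! g ≡ x ! g xor y ! g
  ⊕-coeff x y g = lookup-zipWith _xor_ g x y

  •-coeff : ∀ c x g → (c • x) ! g ≡ c ∧ x ! g
  •-coeff c x g = lookup-map g (c ∧_) x

  𝟘-coeff : ∀ g → 𝟘 ! g ≡ false
  𝟘-coeff g = lookup-replicate g false

  ⋆-comm : ∀ x y → x ⋆ y ≡ y ⋆ x
  ⋆-comm x y = vec-ext λ g → begin
    (x ⋆ y) ! g                                              ≡⟨ ⋆-coeff x y g ⟩
    sumF (λ h → x ! h ∧ y ! (h ⁻¹ ∙ g))                      ≡⟨ sumF-cong (λ h → trans (∧-comm (x ! h) _)
                                                                  (cong (λ k → y ! (h ⁻¹ ∙ g) ∧ x ! k) (sym (reflect-involutive g h)))) ⟩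
    sumF (λ h → y ! (h ⁻¹ ∙ g) ∧ x ! ((h ⁻¹ ∙ g) ⁻¹ ∙ g))   ≡⟨ sumF-reflect g (λ k → y ! k ∧ x ! (k ⁻¹ ∙ g)) ⟩
    sumF (λ k → y ! k ∧ x ! (k ⁻¹ ∙ g))                      ≡⟨ sym (⋆-coeff y x g) ⟩
    (y ⋆ x) ! g                                              ∎

  ⋆-assoc : ∀ x y z → (x ⋆ y) ⋆ z ≡ x ⋆ (y ⋆ z)
  ⋆-assoc x y z = vec-ext λ g → begin
    ((x ⋆ y) ⋆ z) ! g
      ≡⟨ ⋆-coeff (x ⋆ y) z g ⟩
    sumF (λ h → (x ⋆ y) ! h ∧ z ! (h ⁻¹ ∙ g))
      ≡⟨ sumF-cong (λ h → trans (cong (_∧ z ! (h ⁻¹ ∙ g)) (⋆-coeff x y h)) (sym (sumF-∧ʳ {order} _ _))) ⟩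
    sumF (λ h → sumF (λ k → (x ! k ∧ y ! (k ⁻¹ ∙ h)) ∧ z ! (h ⁻¹ ∙ g)))
      ≡⟨ sumF-swap (λ h k → (x ! k ∧ y ! (k ⁻¹ ∙ h)) ∧ z ! (h ⁻¹ ∙ g)) ⟩
    sumF (λ k → sumF (λ h → (x ! k ∧ y ! (k ⁻¹ ∙ h)) ∧ z ! (h ⁻¹ ∙ g)))
      ≡⟨ sumF-cong (λ k → trans (sumF-cong {order} (λ h → ∧-assoc (x ! k) _ _)) (sumF-∧ˡ {order} (x ! k) _)) ⟩
    sumF (λ k → x ! k ∧ sumF (λ h → y ! (k ⁻¹ ∙ h) ∧ z ! (h ⁻¹ ∙ g)))
      ≡⟨ sumF-cong (λ k → cong (x ! k ∧_) (inner k)) ⟩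
    sumF (λ k → x ! k ∧ (y ⋆ z) ! (k ⁻¹ ∙ g))
      ≡⟨ sym (⋆-coeff x (y ⋆ z) g) ⟩
    (x ⋆ (y ⋆ z)) ! g ∎
    where
    -- substituting h = k m in the inner sum
    inner : ∀ {g} k → sumF (λ h → y ! (k ⁻¹ ∙ h) ∧ z ! (h ⁻¹ ∙ g)) ≡ (y ⋆ z) ! (k ⁻¹ ∙ g)
    inner {g} k = begin
      sumF (λ h → y ! (k ⁻¹ ∙ h) ∧ z ! (h ⁻¹ ∙ g))                   ≡⟨ sym (sumF-translate k _) ⟩
      sumF (λ m → y ! (k ⁻¹ ∙ (k ∙ m)) ∧ z ! ((k ∙ m) ⁻¹ ∙ g))       ≡⟨ sumF-cong (λ m → cong₂ _∧_
                                                                          (cong (y !_) (\\-leftDividesʳ k m))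
                                                                          (cong (z !_) (regroup m))) ⟩
      sumF (λ m → y ! m ∧ z ! (m ⁻¹ ∙ (k ⁻¹ ∙ g)))                    ≡⟨ sym (⋆-coeff y z (k ⁻¹ ∙ g)) ⟩
      (y ⋆ z) ! (k ⁻¹ ∙ g)                                           ∎
      where
      regroup : ∀ m → (k ∙ m) ⁻¹ ∙ g ≡ m ⁻¹ ∙ (k ⁻¹ ∙ g)
      regroup m = trans (cong (_∙ g) (trans (sym (⁻¹-∙-comm k m)) (comm _ _))) (assoc _ _ _)

  ⋆-distribˡ : ∀ x y z → x ⋆ (y ⊕ z) ≡ x ⋆ y ⊕ x ⋆ z
  ⋆-distribˡ x y z = vec-ext λ g → begin
    (x ⋆ (y ⊕ z)) ! g
      ≡⟨ ⋆-coeff x (y ⊕ z) g ⟩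
    sumF (λ h → x ! h ∧ (y ⊕ z) ! (h ⁻¹ ∙ g))
      ≡⟨ sumF-cong (λ h → trans (cong (x ! h ∧_) (⊕-coeff y z _)) (∧-distribˡ-xor (x ! h) _ _)) ⟩
    sumF (λ h → (x ! h ∧ y ! (h ⁻¹ ∙ g)) xor (x ! h ∧ z ! (h ⁻¹ ∙ g)))
      ≡⟨ sumF-xor {order} _ _ ⟩
    sumF (λ h → x ! h ∧ y ! (h ⁻¹ ∙ g)) xor sumF (λ h → x ! h ∧ z ! (h ⁻¹ ∙ g))
      ≡⟨ sym (trans (⊕-coeff (x ⋆ y) (x ⋆ z) g) (cong₂ _xor_ (⋆-coeff x y g) (⋆-coeff x z g))) ⟩
    (x ⋆ y ⊕ x ⋆ z) ! g ∎

  ⋆-homogeneous : ∀ c x y → x ⋆ (c • y) ≡ c • (x ⋆ y)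
  ⋆-homogeneous c x y = vec-ext λ g → begin
    (x ⋆ (c • y)) ! g
      ≡⟨ ⋆-coeff x (c • y) g ⟩
    sumF (λ h → x ! h ∧ (c • y) ! (h ⁻¹ ∙ g))
      ≡⟨ sumF-cong (λ h → trans (cong (x ! h ∧_) (•-coeff c y _)) (∧.x∙yz≈y∙xz (x ! h) c _)) ⟩
    sumF (λ h → c ∧ (x ! h ∧ y ! (h ⁻¹ ∙ g)))
      ≡⟨ sumF-∧ˡ {order} c _ ⟩
    c ∧ sumF (λ h → x ! h ∧ y ! (h ⁻¹ ∙ g))
      ≡⟨ sym (trans (•-coeff c (x ⋆ y) g) (cong (c ∧_) (⋆-coeff x y g))) ⟩
    (c • (x ⋆ y)) ! g ∎

  act-coeff : ∀ σ x g → act G σ x ! g ≡ x ! (σ ⁻¹ ∙ g)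
  act-coeff σ x g = begin
    ([ σ ] ⋆ x) ! g                                 ≡⟨ ⋆-coeff [ σ ] x g ⟩
    sumF (λ h → [ σ ] ! h ∧ x ! (h ⁻¹ ∙ g))         ≡⟨ sumF-cong (λ h → trans (cong (_∧ x ! (h ⁻¹ ∙ g)) ([]-coeff σ h))
                                                                           (∧-comm (eqᵇ h σ) _)) ⟩
    sumF (λ h → x ! (h ⁻¹ ∙ g) ∧ eqᵇ h σ)           ≡⟨ sumF-delta (λ h → x ! (h ⁻¹ ∙ g)) σ ⟩
    x ! (σ ⁻¹ ∙ g)                                  ∎

  act-basis : ∀ σ k → act G σ [ k ] ≡ [ σ ∙ k ]
  act-basis σ k = vec-ext λ g → begin
    act G σ [ k ] ! g      ≡⟨ act-coeff σ [ k ] g ⟩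
    [ k ] ! (σ ⁻¹ ∙ g)     ≡⟨ []-coeff k _ ⟩
    eqᵇ (σ ⁻¹ ∙ g) k       ≡⟨ eqᵇ-⇔ (λ p → trans (sym (\\-leftDividesˡ σ g)) (cong (σ ∙_) p))
                                    (λ p → trans (cong (σ ⁻¹ ∙_) p) (\\-leftDividesʳ σ k)) ⟩
    eqᵇ g (σ ∙ k)          ≡⟨ sym ([]-coeff (σ ∙ k) g) ⟩
    [ σ ∙ k ] ! g          ∎

  ⋆-identityˡ : ∀ x → [ ε ] ⋆ x ≡ x
  ⋆-identityˡ x = vec-ext λ g → trans (act-coeff ε x g) (cong (x !_) (trans (cong (_∙ g) ε⁻¹≈ε) (identityˡ g)))

  ^*-⋆ : ∀ x y → (x ⋆ y) ^* ≡ x ^* ⋆ y ^*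
  ^*-⋆ x y = vec-ext λ g → begin
    (x ⋆ y) ^* ! g                                    ≡⟨ trans (^*-coeff (x ⋆ y) g) (⋆-coeff x y (g ⁻¹)) ⟩
    sumF (λ h → x ! h ∧ y ! (h ⁻¹ ∙ g ⁻¹))            ≡⟨ sym (sumF-inverse (λ h → x ! h ∧ y ! (h ⁻¹ ∙ g ⁻¹))) ⟩
    sumF (λ h → x ! (h ⁻¹) ∧ y ! (h ⁻¹ ⁻¹ ∙ g ⁻¹))    ≡⟨ sumF-cong (λ h → sym (cong₂ _∧_ (^*-coeff x h)
                                                             (trans (^*-coeff y (h ⁻¹ ∙ g)) (cong (y !_) (sym (⁻¹-∙-comm (h ⁻¹) g)))))) ⟩
    sumF (λ h → x ^* ! h ∧ y ^* ! (h ⁻¹ ∙ g))         ≡⟨ sym (⋆-coeff (x ^*) (y ^*) g) ⟩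
    (x ^* ⋆ y ^*) ! g                                 ∎

  [ε]^* : [ ε ] ^* ≡ [ ε ]
  [ε]^* = vec-ext λ g → begin
    [ ε ] ^* ! g     ≡⟨ trans (^*-coeff [ ε ] g) ([]-coeff ε (g ⁻¹)) ⟩
    eqᵇ (g ⁻¹) ε     ≡⟨ eqᵇ-⇔ (λ p → ⁻¹-injective (trans p (sym ε⁻¹≈ε))) (λ p → trans (cong _⁻¹ p) ε⁻¹≈ε) ⟩
    eqᵇ g ε          ≡⟨ sym ([]-coeff ε g) ⟩
    [ ε ] ! g        ∎

  ⊕-self : ∀ x → x ⊕ x ≡ 𝟘
  ⊕-self x = vec-ext λ g → trans (⊕-coeff x x g) (trans (xor-same (x ! g)) (sym (𝟘-coeff g)))

  ⊕≡𝟘⇒≡ : ∀ x y → x ⊕ y ≡ 𝟘 → x ≡ y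
  ⊕≡𝟘⇒≡ x y sum≡𝟘 = vec-ext λ g → xor≡false (trans (sym (⊕-coeff x y g)) (trans (cong (_! g) sum≡𝟘) (𝟘-coeff g)))
    where
    xor≡false : ∀ {a b} → a xor b ≡ false → a ≡ b
    xor≡false {true}  {true}  _ = refl
    xor≡false {false} {false} _ = refl

  ⟨_,_⟩ : V → V → Bool
  ⟨ x , y ⟩ = sumF (λ g → x ! g ∧ y ! g)

  IsGForm : Form G → Set
  IsGForm b = IsBilinear G b × IsGInvariant G b × IsSymmetric G b × IsNondegenerate G b

  ⟨⟩-basis : ∀ x g → ⟨ x , [ g ] ⟩ ≡ x ! g
  ⟨⟩-basis x g = trans (sumF-cong (λ h → cong (x ! h ∧_) ([]-coeff g h))) (sumF-delta (x !_) g)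

  ⟨⟩-zeroˡ : ∀ z → ⟨ 𝟘 , z ⟩ ≡ false
  ⟨⟩-zeroˡ z = trans (sumF-cong (λ g → cong (_∧ z ! g) (𝟘-coeff g))) (sumF-false {order})

  ⟨⟩-symmetric : IsSymmetric G ⟨_,_⟩
  ⟨⟩-symmetric x y = sumF-cong (λ g → ∧-comm (x ! g) (y ! g))

  ⟨⟩-isGForm : IsGForm ⟨_,_⟩
  ⟨⟩-isGForm = (addˡ , homˡ , addʳ , homʳ) , invariant , ⟨⟩-symmetric , nondegenerate
    where
    addˡ : ∀ x y z → ⟨ x ⊕ y , z ⟩ ≡ ⟨ x , z ⟩ xor ⟨ y , z ⟩
    addˡ x y z = trans (sumF-cong (λ g → trans (cong (_∧ z ! g) (⊕-coeff x y g)) (∧-distribʳ-xor (z ! g) (x ! g) (y ! g))))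
                       (sumF-xor {order} _ _)
    addʳ : ∀ x y z → ⟨ x , y ⊕ z ⟩ ≡ ⟨ x , y ⟩ xor ⟨ x , z ⟩
    addʳ x y z = trans (sumF-cong (λ g → trans (cong (x ! g ∧_) (⊕-coeff y z g)) (∧-distribˡ-xor (x ! g) (y ! g) (z ! g))))
                       (sumF-xor {order} _ _)
    homˡ : ∀ c x z → ⟨ c • x , z ⟩ ≡ c ∧ ⟨ x , z ⟩
    homˡ c x z = trans (sumF-cong (λ g → trans (cong (_∧ z ! g) (•-coeff c x g)) (∧-assoc c _ _))) (sumF-∧ˡ {order} c _)
    homʳ : ∀ c x z → ⟨ x , c • z ⟩ ≡ c ∧ ⟨ x , z ⟩
    homʳ c x z = trans (sumF-cong (λ g → trans (cong (x ! g ∧_) (•-coeff c z g))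
      (∧.x∙yz≈y∙xz (x ! g) c (z ! g)))) (sumF-∧ˡ {order} c _)
    invariant : IsGInvariant G ⟨_,_⟩
    invariant σ x y = trans (sumF-cong (λ g → cong₂ _∧_ (act-coeff σ x g) (act-coeff σ y g)))
                            (sumF-translate (σ ⁻¹) (λ g → x ! g ∧ y ! g))
    nondegenerate : IsNondegenerate G ⟨_,_⟩
    nondegenerate x ⊥x = vec-ext λ g → trans (sym (⟨⟩-basis x g)) (trans (⊥x [ g ]) (sym (𝟘-coeff g)))

  ⟨⟩-via-⋆ : ∀ x y → ⟨ x , y ⟩ ≡ (x ^* ⋆ y) ! ε
  ⟨⟩-via-⋆ x y = sym (begin
    (x ^* ⋆ y) ! ε                               ≡⟨ ⋆-coeff (x ^*) y ε ⟩
    sumF (λ h → x ^* ! h ∧ y ! (h ⁻¹ ∙ ε))       ≡⟨ sumF-cong (λ h → cong₂ _∧_ (^*-coeff x h) (cong (y !_) (identityʳ _))) ⟩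
    sumF (λ h → x ! (h ⁻¹) ∧ y ! (h ⁻¹))         ≡⟨ sumF-inverse (λ h → x ! h ∧ y ! h) ⟩
    ⟨ x , y ⟩                                    ∎)

  ⟨⟩-adjoint : ∀ u x z → ⟨ u ⋆ x , z ⟩ ≡ ⟨ x , u ^* ⋆ z ⟩
  ⟨⟩-adjoint u x z = begin
    ⟨ u ⋆ x , z ⟩                   ≡⟨ ⟨⟩-via-⋆ (u ⋆ x) z ⟩
    ((u ⋆ x) ^* ⋆ z) ! ε            ≡⟨ cong (λ w → (w ⋆ z) ! ε) (trans (^*-⋆ u x) (⋆-comm (u ^*) (x ^*))) ⟩
    (x ^* ⋆ u ^* ⋆ z) ! ε           ≡⟨ cong (_! ε) (⋆-assoc (x ^*) (u ^*) z) ⟩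
    (x ^* ⋆ (u ^* ⋆ z)) ! ε         ≡⟨ sym (⟨⟩-via-⋆ x (u ^* ⋆ z)) ⟩
    ⟨ x , u ^* ⋆ z ⟩                ∎

  ⋆-linear : ∀ u → IsLinear G (u ⋆_)
  ⋆-linear u = ⋆-distribˡ u , λ c x → ⋆-homogeneous c u x

  ⋆-equivariant : ∀ u → IsGEquivariant G (u ⋆_)
  ⋆-equivariant u σ x = begin
    u ⋆ ([ σ ] ⋆ x)   ≡⟨ sym (⋆-assoc u [ σ ] x) ⟩
    u ⋆ [ σ ] ⋆ x     ≡⟨ cong (_⋆ x) (⋆-comm u [ σ ]) ⟩
    [ σ ] ⋆ u ⋆ x     ≡⟨ ⋆-assoc [ σ ] u x ⟩
    [ σ ] ⋆ (u ⋆ x)   ∎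

  ⋆-cancel : ∀ u v → u ⋆ v ≡ [ ε ] → ∀ x → v ⋆ (u ⋆ x) ≡ x
  ⋆-cancel u v uv≡1 x = begin
    v ⋆ (u ⋆ x)   ≡⟨ sym (⋆-assoc v u x) ⟩
    v ⋆ u ⋆ x     ≡⟨ cong (_⋆ x) (trans (⋆-comm v u) uv≡1) ⟩
    [ ε ] ⋆ x     ≡⟨ ⋆-identityˡ x ⟩
    x             ∎

  ⋆-bijective : ∀ u v → u ⋆ v ≡ [ ε ] → IsBijective G (u ⋆_)
  ⋆-bijective u v uv≡1 = (v ⋆_) , ⋆-cancel u v uv≡1 , ⋆-cancel v u (trans (⋆-comm v u) uv≡1)

  ∑ᵛ : ∀ {m} → (Fin m → V) → V
  ∑ᵛ {zero}  v = 𝟘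
  ∑ᵛ {suc m} v = v zero ⊕ ∑ᵛ (v ∘ suc)

  ∑ᵛ-coeff : ∀ {m} (v : Fin m → V) g → ∑ᵛ v ! g ≡ sumF (λ j → v j ! g)
  ∑ᵛ-coeff {zero}  v g = 𝟘-coeff g
  ∑ᵛ-coeff {suc m} v g = trans (⊕-coeff (v zero) (∑ᵛ (v ∘ suc)) g) (cong (v zero ! g xor_) (∑ᵛ-coeff (v ∘ suc) g))

  basis-expansion : ∀ x → x ≡ ∑ᵛ (λ h → x ! h • [ h ])
  basis-expansion x = vec-ext λ g → sym (begin
    ∑ᵛ (λ h → x ! h • [ h ]) ! g     ≡⟨ ∑ᵛ-coeff (λ h → x ! h • [ h ]) g ⟩
    sumF (λ h → (x ! h • [ h ]) ! g)  ≡⟨ sumF-cong (λ h → trans (•-coeff (x ! h) [ h ] g) (cong (x ! h ∧_) ([]-coeff h g))) ⟩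
    sumF (λ h → x ! h ∧ eqᵇ g h)      ≡⟨ sumF-cong (λ h → cong (x ! h ∧_) (eqᵇ-⇔ sym sym)) ⟩
    sumF (λ h → x ! h ∧ eqᵇ h g)      ≡⟨ sumF-delta (x !_) g ⟩
    x ! g                             ∎)

  linear-expansion : (F : V → Bool) → (∀ x y → F (x ⊕ y) ≡ F x xor F y) → (∀ c x → F (c • x) ≡ c ∧ F x) →
                     ∀ x → F x ≡ sumF (λ h → x ! h ∧ F [ h ])
  linear-expansion F additive homogeneous x =
    trans (cong F (basis-expansion x)) (trans (F-∑ᵛ (λ h → x ! h • [ h ])) (sumF-cong (λ h → homogeneous (x ! h) [ h ])))
    where
    F-𝟘 : F 𝟘 ≡ false
    F-𝟘 = trans (cong F (sym (⊕-self 𝟘))) (trans (additive 𝟘 𝟘) (xor-same (F 𝟘)))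
    F-∑ᵛ : ∀ {m} (v : Fin m → V) → F (∑ᵛ v) ≡ sumF (λ j → F (v j))
    F-∑ᵛ {zero}  v = F-𝟘
    F-∑ᵛ {suc m} v = trans (additive _ _) (cong (F (v zero) xor_) (F-∑ᵛ (v ∘ suc)))

  IsGForm-resp : ∀ {b b′} → (∀ x y → b x y ≡ b′ x y) → IsGForm b → IsGForm b′
  IsGForm-resp {b} {b′} b≡b′ ((addˡ , homˡ , addʳ , homʳ) , invariant , symmetric , nondegenerate) =
    ( (λ x y z → trans (sym (b≡b′ (x ⊕ y) z)) (trans (addˡ x y z) (cong₂ _xor_ (b≡b′ x z) (b≡b′ y z))))
    , (λ c x z → trans (sym (b≡b′ (c • x) z)) (trans (homˡ c x z) (cong (c ∧_) (b≡b′ x z))))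
    , (λ x y z → trans (sym (b≡b′ x (y ⊕ z))) (trans (addʳ x y z) (cong₂ _xor_ (b≡b′ x y) (b≡b′ x z))))
    , (λ c x z → trans (sym (b≡b′ x (c • z))) (trans (homʳ c x z) (cong (c ∧_) (b≡b′ x z)))) )
    , (λ σ x y → trans (sym (b≡b′ (act G σ x) (act G σ y))) (trans (invariant σ x y) (b≡b′ x y)))
    , (λ x y → trans (sym (b≡b′ x y)) (trans (symmetric x y) (b≡b′ y x)))
    , (λ x ⊥x → nondegenerate x (λ y → trans (b≡b′ x y) (⊥x y)))

  -- Every diagonal entry of multiplication by z (in the basis G) is z_ε,
  -- so Tr(z) = |G| z_ε.
  Tr-diagonal : ∀ z → Tr G z ≡ sumF {order} (λ _ → z ! ε)
  Tr-diagonal z = sumF-cong λ g → begin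
    (z ⋆ [ g ]) ! g      ≡⟨ cong (_! g) (⋆-comm z [ g ]) ⟩
    act G g z ! g        ≡⟨ act-coeff g z g ⟩
    z ! (g ⁻¹ ∙ g)       ≡⟨ cong (z !_) (inverseˡ g) ⟩
    z ! ε                ∎

  -- A G-invariant bilinear form b is determined by its Gram vector
  -- gram_k = b([ ε ] , [ k ]): b(x , y) = ⟨gram x , y⟩.
  module InvariantForm (b : Form G) (bilinear : IsBilinear G b) (invariant : IsGInvariant G b) where

    gram : V
    gram = tabulate (λ k → b [ ε ] [ k ])

    gram-coeff : ∀ h k → b [ h ] [ k ] ≡ gram ! (h ⁻¹ ∙ k)
    gram-coeff h k = begin
      b [ h ] [ k ]                             ≡⟨ cong₂ b (trans (cong [_] (sym (identityʳ h))) (sym (act-basis h ε)))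
                                                          (trans (cong [_] (sym (\\-leftDividesˡ h k))) (sym (act-basis h (h ⁻¹ ∙ k)))) ⟩
      b (act G h [ ε ]) (act G h [ h ⁻¹ ∙ k ])  ≡⟨ invariant h [ ε ] [ h ⁻¹ ∙ k ] ⟩
      b [ ε ] [ h ⁻¹ ∙ k ]                      ≡⟨ sym (lookup∘tabulate (λ k → b [ ε ] [ k ]) (h ⁻¹ ∙ k)) ⟩
      gram ! (h ⁻¹ ∙ k)                         ∎

    -- Expand b in both arguments and regroup the double sum as a product.
    represent : ∀ x y → b x y ≡ ⟨ gram ⋆ x , y ⟩
    represent x y = begin
      b x y
        ≡⟨ linear-expansion (λ u → b u y) (λ u v → additiveˡ u v y) (λ c u → homogeneousˡ c u y) x ⟩
      sumF (λ g → x ! g ∧ b [ g ] y)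
        ≡⟨ sumF-cong (λ g → cong (x ! g ∧_) (trans (linear-expansion (b [ g ]) (additiveʳ [ g ]) (λ c v → homogeneousʳ c [ g ] v) y)
                                                  (sumF-cong (λ h → cong (y ! h ∧_) (gram-coeff g h))))) ⟩
      sumF (λ g → x ! g ∧ sumF (λ h → y ! h ∧ gram ! (g ⁻¹ ∙ h)))
        ≡⟨ sumF-cong (λ g → sym (sumF-∧ˡ {order} (x ! g) _)) ⟩
      sumF (λ g → sumF (λ h → x ! g ∧ (y ! h ∧ gram ! (g ⁻¹ ∙ h))))
        ≡⟨ sumF-swap (λ g h → x ! g ∧ (y ! h ∧ gram ! (g ⁻¹ ∙ h))) ⟩
      sumF (λ h → sumF (λ g → x ! g ∧ (y ! h ∧ gram ! (g ⁻¹ ∙ h))))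
        ≡⟨ sumF-cong (λ h → trans (sumF-cong {order} (λ g → ∧.x∙yz≈xz∙y (x ! g) (y ! h) _)) (sumF-∧ʳ {order} (y ! h) _)) ⟩
      sumF (λ h → sumF (λ g → x ! g ∧ gram ! (g ⁻¹ ∙ h)) ∧ y ! h)
        ≡⟨ sumF-cong (λ h → cong (_∧ y ! h) (trans (sym (⋆-coeff x gram h)) (cong (_! h) (⋆-comm x gram)))) ⟩
      ⟨ gram ⋆ x , y ⟩ ∎
      where
      additiveˡ = proj₁ bilinear
      homogeneousˡ = proj₁ (proj₂ bilinear)
      additiveʳ = proj₁ (proj₂ (proj₂ bilinear))
      homogeneousʳ = proj₂ (proj₂ (proj₂ bilinear))

    gram-self-adjoint : IsSymmetric G b → gram ^* ≡ gram
    gram-self-adjoint symmetric = vec-ext λ k → begin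
      gram ^* ! k            ≡⟨ ^*-coeff gram k ⟩
      gram ! (k ⁻¹)          ≡⟨ cong (gram !_) (sym (identityʳ (k ⁻¹))) ⟩
      gram ! (k ⁻¹ ∙ ε)      ≡⟨ sym (gram-coeff k ε) ⟩
      b [ k ] [ ε ]          ≡⟨ symmetric [ k ] [ ε ] ⟩
      b [ ε ] [ k ]          ≡⟨ sym (lookup∘tabulate (λ k → b [ ε ] [ k ]) k) ⟩
      gram ! k               ∎

    gram-injective : IsNondegenerate G b → Injective _≡_ _≡_ (gram ⋆_)
    gram-injective nondegenerate {x} {y} same = ⊕≡𝟘⇒≡ x y (nondegenerate (x ⊕ y) λ z → begin
      b (x ⊕ y) z                  ≡⟨ represent (x ⊕ y) z ⟩
      ⟨ gram ⋆ (x ⊕ y) , z ⟩       ≡⟨ cong (λ w → ⟨ w , z ⟩) (trans (⋆-distribˡ gram x y)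
                                                                     (trans (cong (gram ⋆ x ⊕_) (sym same)) (⊕-self _))) ⟩
      ⟨ 𝟘 , z ⟩                    ≡⟨ ⟨⟩-zeroˡ z ⟩
      false                        ∎)

    -- Since F₂[G] is finite, the injective map x ↦ gram x is onto; gram is a unit.
    gram-invertible : IsNondegenerate G b → ∃ λ a → gram ⋆ a ≡ [ ε ]
    gram-invertible nondegenerate =
      ↔Fin-injective⇒surjective (Bits↔Fin order) (gram ⋆_) (gram-injective nondegenerate) [ ε ]

  module OddOrder (odd : ¬ 2 ∣ order) where

    trace-coeff : ∀ z → Tr G z ≡ z ! ε
    trace-coeff z = trans (Tr-diagonal z) (sumF-odd-const order odd (z ! ε))

    trForm≡⟨⟩ : ∀ x y → trForm G x y ≡ ⟨ x , y ⟩
    trForm≡⟨⟩ x y = trans (trace-coeff (x ^* ⋆ y)) (sym (⟨⟩-via-⋆ x y))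

    trForm-isGForm : IsGForm (trForm G)
    trForm-isGForm = IsGForm-resp (λ x y → sym (trForm≡⟨⟩ x y)) ⟨⟩-isGForm

    -- Pair each h with h t: if t² = ε ≠ t there are no fixed points and |G| is even.
    no-element-of-order-two : ∀ t → t ∙ t ≡ ε → t ≡ ε
    no-element-of-order-two t tt≡ε with t ≟ ε
    ... | yes t≡ε = t≡ε
    ... | no  t≢ε = ⊥-elim (true≢false (begin
      true                                             ≡⟨ sym (sumF-odd-const order odd true) ⟩
      sumF {order} (λ _ → true)                        ≡⟨ sumF-involution (λ _ → true) (_∙ t) involutive (λ _ → refl) ⟩
      sumF {order} (λ h → true ∧ eqᵇ (h ∙ t) h)        ≡⟨ sumF-cong (λ h → ⌊⌋-no (h ∙ t ≟ h) (t≢ε ∘ unmoved h)) ⟩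
      sumF {order} (λ _ → false)                       ≡⟨ sumF-false {order} ⟩
      false                                            ∎))
      where
      involutive : ∀ h → h ∙ t ∙ t ≡ h
      involutive h = trans (assoc h t t) (trans (cong (h ∙_) tt≡ε) (identityʳ h))
      unmoved : ∀ h → h ∙ t ≡ h → t ≡ ε
      unmoved h ht≡h = ∙-cancelˡ h t ε (trans ht≡h (sym (identityʳ h)))
      true≢false : true ≢ false
      true≢false ()

    square-injective : Injective _≡_ _≡_ (λ g → g ∙ g)
    square-injective {g} {h} gg≡hh = x∙y⁻¹≈ε⇒x≈y g h (no-element-of-order-two (g ∙ h ⁻¹) (begin
      g ∙ h ⁻¹ ∙ (g ∙ h ⁻¹)    ≡⟨ interchange g (h ⁻¹) g (h ⁻¹) ⟩
      g ∙ g ∙ (h ⁻¹ ∙ h ⁻¹)    ≡⟨ cong (_∙ (h ⁻¹ ∙ h ⁻¹)) gg≡hh ⟩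
      h ∙ h ∙ (h ⁻¹ ∙ h ⁻¹)    ≡⟨ interchange h h (h ⁻¹) (h ⁻¹) ⟩
      h ∙ h ⁻¹ ∙ (h ∙ h ⁻¹)    ≡⟨ cong₂ _∙_ (inverseʳ h) (inverseʳ h) ⟩
      ε ∙ ε                    ≡⟨ identityˡ ε ⟩
      ε                        ∎))

    square-root : ∀ g → ∃ λ r → r ∙ r ≡ g
    square-root = Fin-injective⇒surjective (λ g → g ∙ g) square-injective

    √ : V → V
    √ a = tabulate (λ h → a ! (h ∙ h))

    √-coeff : ∀ a h → √ a ! h ≡ a ! (h ∙ h)
    √-coeff a h = lookup∘tabulate (λ h → a ! (h ∙ h)) h

    -- (√ a)² = a: in (√ a ⋆ √ a)_g the terms pair up under h ↦ h⁻¹ g except for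
    -- the fixed point h = r, the square root of g, which contributes a_g.
    √-squared : ∀ a → √ a ⋆ √ a ≡ a
    √-squared a = vec-ext coeff
      where
      s : V
      s = √ a
      coeff : ∀ g → (s ⋆ s) ! g ≡ a ! g
      coeff g with square-root g
      ... | r , rr≡g = begin
        (s ⋆ s) ! g                             ≡⟨ ⋆-coeff s s g ⟩
        sumF f                                  ≡⟨ sumF-involution f (λ h → h ⁻¹ ∙ g) (reflect-involutive g) f-reflect ⟩
        sumF (λ h → f h ∧ eqᵇ (h ⁻¹ ∙ g) h)     ≡⟨ sumF-cong (λ h → cong (f h ∧_) (fixed⇔root h)) ⟩
        sumF (λ h → f h ∧ eqᵇ h r)              ≡⟨ sumF-delta f r ⟩
        s ! r ∧ s ! (r ⁻¹ ∙ g)                  ≡⟨ trans (cong (λ k → s ! r ∧ s ! k) r⁻¹g≡r) (∧-idem (s ! r)) ⟩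
        s ! r                                   ≡⟨ trans (√-coeff a r) (cong (a !_) rr≡g) ⟩
        a ! g                                   ∎
        where
        f : Fin order → Bool
        f h = s ! h ∧ s ! (h ⁻¹ ∙ g)
        f-reflect : ∀ h → f (h ⁻¹ ∙ g) ≡ f h
        f-reflect h = trans (cong (λ k → s ! (h ⁻¹ ∙ g) ∧ s ! k) (reflect-involutive g h)) (∧-comm (s ! (h ⁻¹ ∙ g)) (s ! h))
        r⁻¹g≡r : r ⁻¹ ∙ g ≡ r
        r⁻¹g≡r = trans (cong (r ⁻¹ ∙_) (sym rr≡g)) (\\-leftDividesʳ r r)
        fixed⇔root : ∀ h → eqᵇ (h ⁻¹ ∙ g) h ≡ eqᵇ h r
        fixed⇔root h = eqᵇ-⇔ (λ fixed → square-injective (trans (reflect-fixed g h fixed) (sym rr≡g)))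
                              (λ { refl → r⁻¹g≡r })

    √-self-adjoint : ∀ a → a ^* ≡ a → √ a ^* ≡ √ a
    √-self-adjoint a a^*≡a = vec-ext λ h → begin
      √ a ^* ! h               ≡⟨ trans (^*-coeff (√ a) h) (√-coeff a (h ⁻¹)) ⟩
      a ! (h ⁻¹ ∙ h ⁻¹)        ≡⟨ cong (a !_) (⁻¹-∙-comm h h) ⟩
      a ! ((h ∙ h) ⁻¹)         ≡⟨ sym (^*-coeff a (h ∙ h)) ⟩
      a ^* ! (h ∙ h)           ≡⟨ cong (_! (h ∙ h)) a^*≡a ⟩
      a ! (h ∙ h)              ≡⟨ sym (√-coeff a h) ⟩
      √ a ! h                  ∎

    -- Every G-form b is isometric to the trace form via multiplication by s,
    -- where s² = a is the inverse of the Gram vector of b.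
    classification : ∀ b → IsGForm b → EquivIsometry G (trForm G) b
    classification b (bilinear , invariant , symmetric , nondegenerate) =
      (s ⋆_) , ⋆-linear s , ⋆-bijective s (s ⋆ gram) s⋆s⋆gram≡1 , ⋆-equivariant s , isometry
      where
      open InvariantForm b bilinear invariant
      a : V
      a = proj₁ (gram-invertible nondegenerate)
      gram⋆a≡1 : gram ⋆ a ≡ [ ε ]
      gram⋆a≡1 = proj₂ (gram-invertible nondegenerate)

      a-self-adjoint : a ^* ≡ a
      a-self-adjoint = gram-injective nondegenerate (begin
        gram ⋆ a ^*          ≡⟨ cong (_⋆ a ^*) (sym (gram-self-adjoint symmetric)) ⟩
        gram ^* ⋆ a ^*       ≡⟨ sym (^*-⋆ gram a) ⟩
        (gram ⋆ a) ^*        ≡⟨ cong _^* gram⋆a≡1 ⟩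
        [ ε ] ^*             ≡⟨ [ε]^* ⟩
        [ ε ]                ≡⟨ sym gram⋆a≡1 ⟩
        gram ⋆ a             ∎)

      s : V
      s = √ a

      s⋆s⋆gram≡1 : s ⋆ (s ⋆ gram) ≡ [ ε ]
      s⋆s⋆gram≡1 = begin
        s ⋆ (s ⋆ gram)   ≡⟨ sym (⋆-assoc s s gram) ⟩
        s ⋆ s ⋆ gram     ≡⟨ cong (_⋆ gram) (√-squared a) ⟩
        a ⋆ gram         ≡⟨ ⋆-comm a gram ⟩
        gram ⋆ a         ≡⟨ gram⋆a≡1 ⟩
        [ ε ]            ∎

      isometry : ∀ x y → b (s ⋆ x) (s ⋆ y) ≡ trForm G x y
      isometry x y = begin
        b (s ⋆ x) (s ⋆ y)                  ≡⟨ represent (s ⋆ x) (s ⋆ y) ⟩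
        ⟨ gram ⋆ (s ⋆ x) , s ⋆ y ⟩         ≡⟨ ⟨⟩-symmetric (gram ⋆ (s ⋆ x)) (s ⋆ y) ⟩
        ⟨ s ⋆ y , gram ⋆ (s ⋆ x) ⟩         ≡⟨ ⟨⟩-adjoint s y (gram ⋆ (s ⋆ x)) ⟩
        ⟨ y , s ^* ⋆ (gram ⋆ (s ⋆ x)) ⟩    ≡⟨ cong (λ u → ⟨ y , u ⋆ (gram ⋆ (s ⋆ x)) ⟩) (√-self-adjoint a a-self-adjoint) ⟩
        ⟨ y , s ⋆ (gram ⋆ (s ⋆ x)) ⟩       ≡⟨ cong ⟨ y ,_⟩ (trans (sym (⋆-assoc s gram (s ⋆ x)))
                                                                (⋆-cancel s (s ⋆ gram) s⋆s⋆gram≡1 x)) ⟩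
        ⟨ y , x ⟩                          ≡⟨ ⟨⟩-symmetric y x ⟩
        ⟨ x , y ⟩                          ≡⟨ sym (trForm≡⟨⟩ x y) ⟩
        trForm G x y                       ∎

theorem3p22 : (G : FinAbGroup) → ¬ (2 ∣ FinAbGroup.order G) →
    (IsBilinear G (trForm G) × IsGInvariant G (trForm G) × IsSymmetric G (trForm G) × IsNondegenerate G (trForm G))
    × (∀ b' → IsBilinear G b' → IsGInvariant G b' → IsSymmetric G b' → IsNondegenerate G b' →
         EquivIsometry G (trForm G) b')
theorem3p22 G odd =
  trForm-isGForm , λ b′ bilinear invariant symmetric nondegenerate →
    classification b′ (bilinear , invariant , symmetric , nondegenerate)
  where open GroupAlgebra.OddOrder G odd
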